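{- Let $t\ge 2$ and $1\le d\le t-1$ be integers, and let $T$ be the $d$-wounded spider $S_{t,t-d}$, i.e. the tree obtained from the star $K_{1,t}$ by subdividing exactly $t-d$ of its edges (each once). Then $T$ is $(\iota,q)$-critical with $q=d+1$.
   Context: For $D\subseteq V(G)$, $N[D]$ is $D$ with all neighbours; $D$ is isolating if $G-N[D]$ has no edges; $\iota(G)$ is the minimum size of an isolating set. For $F\subseteq E(G)$, $G_F$ is obtained by subdividing each edge of $F$ exactly once. For an integer $q\ge1$, $G$ is $(\iota,q)$-critical if $\iota(G_F)>\iota(G)$ for every $F\subseteq E(G)$ with $|F|=q$, and there exists $F'\subseteq E(G)$ with $|F'|=q-1$ with $\iota(G_{F'})=\iota(G)$. -}

module Defs where

open import Data.Nat using (ℕ; zero; suc; _+_; _∸_; _≤_; _<_)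
open import Data.Fin using (Fin; toℕ; splitAt)
open import Data.Fin.Subset using (Subset; _∈_; ∣_∣)
open import Data.List using (List; length; lookup)
open import Data.List.Relation.Unary.All using (All)
open import Data.List.Relation.Unary.Unique.Propositional using (Unique)
open import Data.List.Membership.Propositional renaming (_∈_ to _∈ₗ_)
open import Data.Product using (Σ; _×_; _,_; proj₁; proj₂)
open import Data.Sum using (_⊎_; inj₁; inj₂)
open import Data.Empty using (⊥)
open import Relation.Nullary using (¬_)
open import Relation.Binary.PropositionalEquality using (_≡_)

record Graph : Set₁ where
  field
    n   : ℕ
    Adj : Fin n → Fin n → Set
open Graph public

InN : (G : Graph) → Subset (n G) → Fin (n G) → Set
InN G D x = (x ∈ D) ⊎ Σ (Fin (n G)) (λ y → (y ∈ D) × Adj G x y)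

Isolating : (G : Graph) → Subset (n G) → Set
Isolating G D = ∀ u v → Adj G u v → ¬ InN G D u → ¬ InN G D v → ⊥

IsIota : Graph → ℕ → Set
IsIota G k = Σ (Subset (n G)) (λ D → Isolating G D × ∣ D ∣ ≡ k)
           × (∀ D → Isolating G D → k ≤ ∣ D ∣)

-- A set F ⊆ E(G) of edges, encoded as a duplicate-free list of pairs (u , v)
-- with toℕ u < toℕ v and u ~ v; |F| = length F.
IsEdgeSet : (G : Graph) → List (Fin (n G) × Fin (n G)) → Set
IsEdgeSet G F = All (λ e → (toℕ (proj₁ e) < toℕ (proj₂ e)) × Adj G (proj₁ e) (proj₂ e)) F
              × Unique F

InF : {m : ℕ} → List (Fin m × Fin m) → Fin m → Fin m → Set
InF F a b = ((a , b) ∈ₗ F) ⊎ ((b , a) ∈ₗ F)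

-- G_F : each edge of F subdivided once. Vertices Fin (n + |F|):
-- inj₁ a = original vertex a, inj₂ k = subdivision vertex of the k-th edge of F.
SubAdjS : (G : Graph) (F : List (Fin (n G) × Fin (n G))) →
          (Fin (n G) ⊎ Fin (length F)) → (Fin (n G) ⊎ Fin (length F)) → Set
SubAdjS G F (inj₁ a) (inj₁ b) = Adj G a b × ¬ InF F a b
SubAdjS G F (inj₁ a) (inj₂ k) = (a ≡ proj₁ (lookup F k)) ⊎ (a ≡ proj₂ (lookup F k))
SubAdjS G F (inj₂ k) (inj₁ a) = (a ≡ proj₁ (lookup F k)) ⊎ (a ≡ proj₂ (lookup F k))
SubAdjS G F (inj₂ k) (inj₂ l) = ⊥

Subdivide : (G : Graph) → List (Fin (n G) × Fin (n G)) → Graph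
Subdivide G F = record
  { n   = n G + length F
  ; Adj = λ x y → SubAdjS G F (splitAt (n G) x) (splitAt (n G) y) }

Critical : Graph → ℕ → Set
Critical G q =
  (∀ F → IsEdgeSet G F → length F ≡ q →
     Σ ℕ (λ a → Σ ℕ (λ b → IsIota G a × IsIota (Subdivide G F) b × a < b)))
  × Σ (List (Fin (n G) × Fin (n G))) (λ F' → IsEdgeSet G F' × length F' ≡ q ∸ 1
       × Σ ℕ (λ k → IsIota G k × IsIota (Subdivide G F') k))

-- The spider S_{t,s}: vertices 0 .. t + s; 0 is the centre, 1..t its neighbours,
-- and for 1 ≤ j ≤ s vertex t + j is adjacent to j (so the edges 0j, j ≤ s, are
-- the subdivided ones).
SpE : ℕ → ℕ → ℕ → ℕ → Set
SpE t s a b = (a ≡ 0 × 1 ≤ b × b ≤ t) ⊎ (1 ≤ a × a ≤ s × b ≡ t + a)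

Spider : (t s : ℕ) → Graph
Spider t s = record
  { n   = suc (t + s)
  ; Adj = λ x y → SpE t s (toℕ x) (toℕ y) ⊎ SpE t s (toℕ y) (toℕ x) }

{-# OPTIONS --safe #-}
-- Every edge of the spider S_{t,s} has an endpoint that is the centre c or a subdivided
-- leg, so {c} is isolating and ι = 1; subdividing the d = t − s edges from c to the
-- unsubdivided legs keeps {c} isolating. Once a set F of d + 1 edges is subdivided, no single
-- vertex x isolates S_F, so ι grows. If x subdivides e ∈ F, it misses the subdivision vertex
-- of another f ∈ F together with an endpoint of f not on e. An original vertex x off some
-- f ∈ F misses the subdivision vertex of f and an endpoint of f not adjacent to x (S_{t,s} is
-- bipartite). If x lies on every edge of F, then either x = c, and by pigeonhole F contains
-- an edge cj with j ≤ s, leaving the edge j(t+j) outside N[c]; or x is a subdivided leg and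
-- F = {cx, x(t+x)}, leaving the edge from c to another leg outside N[x].

module Submission where

open import Defs
open import Data.Empty using (⊥; ⊥-elim)
open import Data.Fin using (Fin; zero; suc; toℕ; splitAt; join; fromℕ<; punchIn)
open import Data.Fin.Properties
  using (toℕ-injective; toℕ<n; toℕ-fromℕ<; splitAt-join; join-splitAt; punchInᵢ≢i; injective⇒≤; any?; all?)
  renaming (_≟_ to _≟ᶠ_)
open import Data.Fin.Subset using (Subset; _∈_; _⊆_; ∣_∣; ⁅_⁆; ⊤; Nonempty)
open import Data.Fin.Subset.Properties
  using ( _∈?_; anySubset?; nonempty?; x∈⁅x⁆; x∈⁅y⁆⇒x≡y; ∣⁅x⁆∣≡1; ∣⊤∣≡n; ∈⊤
        ; p⊆q⇒∣p∣≤∣q∣; x∈p∧x≢y⇒x∈p-y; x∈p⇒∣p-x∣<∣p∣)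
open import Data.List using (List; []; _∷_; length; lookup; tabulate)
open import Data.List.Properties using (length-tabulate)
open import Data.List.Membership.Propositional using () renaming (_∈_ to _∈ₗ_)
open import Data.List.Membership.Propositional.Properties using (∈-lookup; ∈-tabulate⁺)
import Data.List.Membership.DecPropositional as DecMembership
open import Data.List.Relation.Unary.All as All using (All)
open import Data.List.Relation.Unary.All.Properties
  using (¬All⇒Any¬) renaming (tabulate⁺ to All-tabulate⁺)
import Data.List.Relation.Unary.Any as Any
open import Data.List.Relation.Unary.Any.Properties using (lookup-index)
open import Data.List.Relation.Unary.Unique.Propositional using (Unique; _∷_)
open import Data.List.Relation.Unary.Unique.Propositional.Properties
  using () renaming (tabulate⁺ to Unique-tabulate⁺)
open import Data.Nat using (ℕ; zero; suc; _+_; _∸_; _≤_; _<_; _≤?_; z≤n; s≤s; s≤s⁻¹)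
open import Data.Nat.Properties using (≤-refl; ≤-trans)
import Data.Nat.Properties as ℕ
open import Data.Product using (Σ; ∃; ∃₂; _×_; _,_; proj₁; proj₂)
open import Data.Product.Properties using (≡-dec)
import Data.Product as Prod
open import Data.Sum using (_⊎_; inj₁; inj₂; [_,_])
import Data.Sum as Sum
open import Data.Sum.Properties using (inj₁-injective)
open import Function using (_∘_; id)
open import Function.Definitions using (Injective)
open import Level using (0ℓ)
open import Relation.Binary using (Rel; Decidable)
open import Relation.Binary.PropositionalEquality
  using (_≡_; _≢_; refl; sym; trans; cong; cong₂; subst; subst₂)
open import Relation.Nullary using (¬_; Dec; yes; no; ¬?)
open import Relation.Nullary.Decidable using (_×-dec_; _⊎-dec_; map′)

least-witness : {P : ℕ → Set} → (∀ k → Dec (P k)) → ∀ {n} → P n →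
                Σ ℕ λ k → P k × (∀ {j} → P j → k ≤ j)
least-witness {P} P? {n} pn = [ id , (λ none → ⊥-elim (none ≤-refl pn)) ] (search n)
  where
  search : ∀ b → (Σ ℕ λ k → P k × (∀ {j} → P j → k ≤ j)) ⊎ (∀ {j} → j ≤ b → ¬ P j)
  search zero with P? zero
  ... | yes p₀ = inj₁ (zero , p₀ , λ _ → z≤n)
  ... | no ¬p₀ = inj₂ λ { z≤n → ¬p₀ }
  search (suc b) with search b | P? (suc b)
  ... | inj₁ least | _     = inj₁ least
  ... | inj₂ none  | yes p = inj₁ (suc b , p , λ pj → ℕ.≰⇒> (λ j≤b → none j≤b pj))
  ... | inj₂ none  | no ¬p = inj₂ λ j≤1+b →
        [ none ∘ s≤s⁻¹ , (λ { refl → ¬p }) ] (ℕ.m≤n⇒m<n∨m≡n j≤1+b)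

module _ {A : Set} (_~_ : Rel A 0ℓ) where

  Dominates : A → A → Set
  Dominates x u = u ≡ x ⊎ u ~ x

  Isolates : A → Set
  Isolates x = ∀ {u v} → u ~ v → Dominates x u ⊎ Dominates x v

  EdgeOutside : A → Set
  EdgeOutside x = ∃₂ λ u v → u ~ v × ¬ Dominates x u × ¬ Dominates x v

TriangleFree : Graph → Set
TriangleFree G = ∀ {x y z} → Adj G x y → Adj G y z → Adj G x z → ⊥

Bipartition : {A : Set} → Rel A 0ℓ → (A → Set) → Set
Bipartition _~_ P = ∀ {x y} → x ~ y → (P x × ¬ P y) ⊎ (¬ P x × P y)

bipartite⇒triangle-free : ∀ {G P} → Bipartition (Adj G) P → TriangleFree G
bipartite⇒triangle-free bip x~y y~z x~z with bip x~y | bip y~z | bip x~z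
... | inj₁ (_ , ¬py) | inj₁ (py , _)  | _              = ¬py py
... | inj₁ _         | inj₂ (_ , pz)  | inj₁ (_ , ¬pz) = ¬pz pz
... | inj₁ (px , _)  | inj₂ _         | inj₂ (¬px , _) = ¬px px
... | inj₂ (_ , py)  | inj₂ (¬py , _) | _              = ¬py py
... | inj₂ (¬px , _) | inj₁ _         | inj₁ (px , _)  = ¬px px
... | inj₂ _         | inj₁ (_ , ¬pz) | inj₂ (_ , pz)  = ¬pz pz

nonempty⇒1≤∣p∣ : ∀ {m} {p : Subset m} → Nonempty p → 1 ≤ ∣ p ∣
nonempty⇒1≤∣p∣ {p = p} (x , x∈p) = subst (_≤ ∣ p ∣) (∣⁅x⁆∣≡1 x)
  (p⊆q⇒∣p∣≤∣q∣ λ y∈⁅x⁆ → subst (_∈ p) (sym (x∈⁅y⁆⇒x≡y x y∈⁅x⁆)) x∈p)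

∣p∣≤1⇒p⊆⁅x⁆ : ∀ {m} {p : Subset m} {x} → ∣ p ∣ ≤ 1 → x ∈ p → p ⊆ ⁅ x ⁆
∣p∣≤1⇒p⊆⁅x⁆ {p = p} {x} ∣p∣≤1 x∈p {y} y∈p with y ≟ᶠ x
... | yes refl = x∈⁅x⁆ y
... | no y≢x   = ⊥-elim (ℕ.<-irrefl refl (ℕ.<-≤-trans 1<∣p∣ ∣p∣≤1))
  where
  1<∣p∣ : 1 < ∣ p ∣
  1<∣p∣ = ℕ.≤-<-trans (nonempty⇒1≤∣p∣ (y , x∈p∧x≢y⇒x∈p-y y∈p y≢x)) (x∈p⇒∣p-x∣<∣p∣ x∈p)

module _ {G : Graph} where

  InN-mono : ∀ {D D′ u} → D ⊆ D′ → InN G D u → InN G D′ u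
  InN-mono D⊆D′ = Sum.map D⊆D′ (Prod.map₂ (Prod.map₁ D⊆D′))

  Isolating-mono : ∀ {D D′} → D ⊆ D′ → Isolating G D → Isolating G D′
  Isolating-mono D⊆D′ iso u v u~v u∉ v∉ = iso u v u~v (u∉ ∘ InN-mono D⊆D′) (v∉ ∘ InN-mono D⊆D′)

  isolating-nonempty : ∀ {D} → ∃₂ (Adj G) → Isolating G D → Nonempty D
  isolating-nonempty {D} (u , v , u~v) iso with nonempty? D
  ... | yes ne = ne
  ... | no empty = ⊥-elim (iso u v u~v outside outside)
    where
    outside : ∀ {w} → ¬ InN G D w
    outside (inj₁ w∈D) = empty (_ , w∈D)
    outside (inj₂ (y , y∈D , _)) = empty (y , y∈D)

  Isolates⇒Isolating-⁅⁆ : ∀ {x} → Isolates (Adj G) x → Isolating G ⁅ x ⁆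
  Isolates⇒Isolating-⁅⁆ {x} iso u v u~v u∉ v∉ = [ u∉ ∘ inN , v∉ ∘ inN ] (iso u~v)
    where
    inN : ∀ {w} → Dominates (Adj G) x w → InN G ⁅ x ⁆ w
    inN (inj₁ refl) = inj₁ (x∈⁅x⁆ x)
    inN (inj₂ w~x)  = inj₂ (x , x∈⁅x⁆ x , w~x)

  EdgeOutside⇒¬Isolating-⁅⁆ : ∀ {x} → EdgeOutside (Adj G) x → ¬ Isolating G ⁅ x ⁆
  EdgeOutside⇒¬Isolating-⁅⁆ {x} (u , v , u~v , u∉ , v∉) iso =
    iso u v u~v (u∉ ∘ dominated) (v∉ ∘ dominated)
    where
    dominated : ∀ {w} → InN G ⁅ x ⁆ w → Dominates (Adj G) x w
    dominated (inj₁ w∈⁅x⁆) = inj₁ (x∈⁅y⁆⇒x≡y x w∈⁅x⁆)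
    dominated {w} (inj₂ (y , y∈⁅x⁆ , w~y)) = inj₂ (subst (Adj G w) (x∈⁅y⁆⇒x≡y x y∈⁅x⁆) w~y)

  ι≡1 : ∀ {x} → ∃₂ (Adj G) → Isolates (Adj G) x → IsIota G 1
  ι≡1 {x} edge iso = (⁅ x ⁆ , Isolates⇒Isolating-⁅⁆ iso , ∣⁅x⁆∣≡1 x) ,
                     λ D isoD → nonempty⇒1≤∣p∣ (isolating-nonempty edge isoD)

  2≤ι : ∀ {k} → Fin (n G) → (∀ x → EdgeOutside (Adj G) x) → IsIota G k → 2 ≤ k
  2≤ι v₀ outside ((D , isoD , refl) , _) = ℕ.≰⇒> ∣D∣≰1
    where
    ∣D∣≰1 : ¬ ∣ D ∣ ≤ 1
    ∣D∣≰1 ∣D∣≤1 with isolating-nonempty (Prod.map₂ (Prod.map₂ proj₁) (outside v₀)) isoD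
    ... | x , x∈D = EdgeOutside⇒¬Isolating-⁅⁆ (outside x) (Isolating-mono (∣p∣≤1⇒p⊆⁅x⁆ ∣D∣≤1 x∈D) isoD)

module _ (G : Graph) (adj? : Decidable (Adj G)) where

  InN? : ∀ D x → Dec (InN G D x)
  InN? D x = (x ∈? D) ⊎-dec any? (λ y → (y ∈? D) ×-dec adj? x y)

  Isolating? : ∀ D → Dec (Isolating G D)
  Isolating? D = map′ (λ h u v u~v u∉ v∉ → h u v (u~v , u∉ , v∉))
                      (λ iso u v (u~v , u∉ , v∉) → iso u v u~v u∉ v∉)
    (all? λ u → all? λ v → ¬? (adj? u v ×-dec ¬? (InN? D u) ×-dec ¬? (InN? D v)))

  ι-exists : Σ ℕ (IsIota G)
  ι-exists with least-witness (λ k → anySubset? λ D → Isolating? D ×-dec (∣ D ∣ ℕ.≟ k))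
                              (⊤ , (λ u _ _ u∉ _ → u∉ (inj₁ ∈⊤)) , ∣⊤∣≡n (n G))
  ... | k , smallest , minimal = k , smallest , λ D iso → minimal (D , iso , refl)

lookup-injective : ∀ {A : Set} {xs : List A} → Unique xs → ∀ {i j} → lookup xs i ≡ lookup xs j → i ≡ j
lookup-injective (_ ∷ _)    {zero}  {zero}  _  = refl
lookup-injective (x∉ ∷ _)   {zero}  {suc j} eq = ⊥-elim (All.lookup x∉ (∈-lookup j) eq)
lookup-injective (x∉ ∷ _)   {suc i} {zero}  eq = ⊥-elim (All.lookup x∉ (∈-lookup i) (sym eq))
lookup-injective (_ ∷ uniq) {suc i} {suc j} eq = cong suc (lookup-injective uniq eq)

∃-distinct-entry : ∀ {A : Set} {xs : List A} → Unique xs → 2 ≤ length xs →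
                   ∀ i → ∃ λ j → lookup xs j ≢ lookup xs i
∃-distinct-entry {xs = _ ∷ []}    _    (s≤s ()) _
∃-distinct-entry {xs = _ ∷ _ ∷ _} uniq _ i = punchIn i zero , punchInᵢ≢i i zero ∘ lookup-injective uniq

Endpoint : {A : Set} → A → A × A → Set
Endpoint c e = c ≡ proj₁ e ⊎ c ≡ proj₂ e

Endpoint? : ∀ {m} (c : Fin m) e → Dec (Endpoint c e)
Endpoint? c e = (c ≟ᶠ proj₁ e) ⊎-dec (c ≟ᶠ proj₂ e)

Ordered : ∀ {m} → Fin m × Fin m → Set
Ordered e = toℕ (proj₁ e) < toℕ (proj₂ e)

other-endpoint : ∀ {m} {e e′ : Fin m × Fin m} → Ordered e → Ordered e′ → e′ ≢ e →
                 ∃ λ c → Endpoint c e′ × ¬ Endpoint c e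
other-endpoint {e = p , q} {p′ , q′} p<q p′<q′ e′≢e with q′ ≟ᶠ p | q′ ≟ᶠ q
... | no q′≢p | no q′≢q = q′ , inj₂ refl , [ q′≢p , q′≢q ]
... | yes refl | _      = p′ , inj₁ refl ,
                          [ ℕ.<⇒≢ p′<q′ ∘ cong toℕ , ℕ.<⇒≢ (ℕ.<-trans p′<q′ p<q) ∘ cong toℕ ]
... | no _ | yes refl   = p′ , inj₁ refl , [ e′≢e ∘ cong (_, q′) , ℕ.<⇒≢ p′<q′ ∘ cong toℕ ]

InF-endpoint : ∀ {m} {F : List (Fin m × Fin m)} {a b c} →
               All (Endpoint a) F → InF F b c → a ≡ b ⊎ a ≡ c
InF-endpoint incident (inj₁ bc∈F) = All.lookup incident bc∈F
InF-endpoint incident (inj₂ cb∈F) = Sum.swap (All.lookup incident cb∈F)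

module Subdivision (G : Graph) (F : List (Fin (n G) × Fin (n G))) where

  Vertex : Set
  Vertex = Fin (n G) ⊎ Fin (length F)

  _~_ : Rel Vertex 0ℓ
  _~_ = SubAdjS G F

  private
    GF : Graph
    GF = Subdivide G F

    split : Fin (n GF) → Vertex
    split = splitAt (n G)

    join′ : Vertex → Fin (n GF)
    join′ = join (n G) (length F)

  adj-join : ∀ {u v} → u ~ v → Adj GF (join′ u) (join′ v)
  adj-join {u} {v} = subst₂ _~_ (sym (splitAt-join _ _ u)) (sym (splitAt-join _ _ v))

  dominates-split : ∀ {X U} → Dominates (Adj GF) X U → Dominates _~_ (split X) (split U)
  dominates-split = Sum.map₁ (cong split)

  split-dominates : ∀ {X U} → Dominates _~_ (split X) (split U) → Dominates (Adj GF) X U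
  split-dominates {X} {U} = Sum.map₁ λ eq →
    trans (sym (join-splitAt (n G) (length F) U))
          (trans (cong join′ eq) (join-splitAt (n G) (length F) X))

  EdgeOutside-join : ∀ X → EdgeOutside _~_ (split X) → EdgeOutside (Adj GF) X
  EdgeOutside-join X (u , v , u~v , u∉ , v∉) = join′ u , join′ v , adj-join u~v , outside u∉ , outside v∉
    where
    outside : ∀ {w} → ¬ Dominates _~_ (split X) w → ¬ Dominates (Adj GF) X (join′ w)
    outside {w} w∉ = w∉ ∘ subst (Dominates _~_ (split X)) (splitAt-join _ _ w) ∘ dominates-split

  Isolates-join : ∀ {x} → Isolates _~_ x → Isolates (Adj GF) (join′ x)
  Isolates-join {x} iso U~V = Sum.map dominated dominated (iso U~V)
    where
    dominated : ∀ {W} → Dominates _~_ x (split W) → Dominates (Adj GF) (join′ x) W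
    dominated {W} = split-dominates ∘ subst (λ y → Dominates _~_ y (split W)) (sym (splitAt-join _ _ x))

  subdivision-edge : ∀ {e} → e ∈ₗ F → ∃ λ k → inj₂ k ~ inj₁ (proj₁ e)
  subdivision-edge e∈F = Any.index e∈F , inj₁ (cong proj₁ (lookup-index e∈F))

  module _ (adj? : Decidable (Adj G)) where

    open DecMembership (≡-dec (_≟ᶠ_ {n G}) (_≟ᶠ_ {n G})) using () renaming (_∈?_ to _∈ₗ?_)

    _~?_ : Decidable _~_
    inj₁ a ~? inj₁ b = adj? a b ×-dec ¬? (((a , b) ∈ₗ? F) ⊎-dec ((b , a) ∈ₗ? F))
    inj₁ a ~? inj₂ k = Endpoint? a (lookup F k)
    inj₂ k ~? inj₁ a = Endpoint? a (lookup F k)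
    inj₂ _ ~? inj₂ _ = no λ ()

    adj-subdivide? : Decidable (Adj GF)
    adj-subdivide? X Y = split X ~? split Y

  subdivision-vertex-avoided : All Ordered F → ∀ {k k′} → lookup F k′ ≢ lookup F k →
                               EdgeOutside _~_ (inj₂ k)
  subdivision-vertex-avoided ordered {k} {k′} e′≢e
    with other-endpoint (All.lookup ordered (∈-lookup k)) (All.lookup ordered (∈-lookup k′)) e′≢e
  ... | c , c∈e′ , c∉e =
    inj₂ k′ , inj₁ c , c∈e′ , [ (λ { refl → e′≢e refl }) , (λ ()) ] , [ (λ ()) , c∉e ]

  endpoint-avoided : ∀ {a k c} → ¬ Endpoint a (lookup F k) → Endpoint c (lookup F k) → ¬ Adj G c a →
                     EdgeOutside _~_ (inj₁ a)
  endpoint-avoided {k = k} {c} a∉e c∈e ¬c~a =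
    inj₂ k , inj₁ c , c∈e , [ (λ ()) , a∉e ] , [ (λ { refl → a∉e c∈e }) , ¬c~a ∘ proj₁ ]

  missed-edge-avoided : TriangleFree G → Decidable (Adj G) → ∀ {a k} →
                        Adj G (proj₁ (lookup F k)) (proj₂ (lookup F k)) → ¬ Endpoint a (lookup F k) →
                        EdgeOutside _~_ (inj₁ a)
  missed-edge-avoided triangle-free adj? {a} {k} p~q a∉e with adj? (proj₁ (lookup F k)) a
  ... | no ¬p~a = endpoint-avoided a∉e (inj₁ refl) ¬p~a
  ... | yes p~a = endpoint-avoided a∉e (inj₂ refl) (λ q~a → triangle-free p~q q~a p~a)

module SpiderProperties {t s : ℕ} (s≤t : s ≤ t) where

  T : Graph
  T = Spider t s

  V : Set
  V = Fin (suc (t + s))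

  LegIndex : ℕ → Set
  LegIndex a = 1 ≤ a × a ≤ t

  Leg : V → Set
  Leg v = LegIndex (toℕ v)

  leg : ∀ k → LegIndex k → V
  leg k (_ , k≤t) = fromℕ< (s≤s (≤-trans k≤t (ℕ.m≤m+n t s)))

  toℕ-leg : ∀ {k} (k-leg : LegIndex k) → toℕ (leg k k-leg) ≡ k
  toℕ-leg _ = toℕ-fromℕ< _

  leg-Leg : ∀ {k} (k-leg : LegIndex k) → Leg (leg k k-leg)
  leg-Leg k-leg = subst LegIndex (sym (toℕ-leg k-leg)) k-leg

  centre-nonleg : ¬ Leg zero
  centre-nonleg (() , _)

  positive⇒≢zero : ∀ {v : V} → 1 ≤ toℕ v → v ≢ zero
  positive⇒≢zero 1≤v v≡0 = ℕ.<⇒≢ 1≤v (sym (cong toℕ v≡0))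

  t+a≰t : ∀ {a} → 1 ≤ a → ¬ t + a ≤ t
  t+a≰t 1≤a = ℕ.<⇒≱ (ℕ.m<m+n t 1≤a)

  t+a≢0 : ∀ {a} → 1 ≤ a → t + a ≢ 0
  t+a≢0 1≤a = ℕ.<⇒≢ (ℕ.<-≤-trans 1≤a (ℕ.m≤n+m _ t)) ∘ sym

  SpE? : ∀ a b → Dec (SpE t s a b)
  SpE? a b = ((a ℕ.≟ 0) ×-dec (1 ≤? b) ×-dec (b ≤? t))
      ⊎-dec ((1 ≤? a) ×-dec (a ≤? s) ×-dec (b ℕ.≟ t + a))

  adj? : Decidable (Adj T)
  adj? x y = SpE? (toℕ x) (toℕ y) ⊎-dec SpE? (toℕ y) (toℕ x)

  SpE-bipartite : ∀ {a b} → SpE t s a b → (LegIndex a × ¬ LegIndex b) ⊎ (¬ LegIndex a × LegIndex b)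
  SpE-bipartite (inj₁ (refl , b-leg))     = inj₂ ((λ { (() , _) }) , b-leg)
  SpE-bipartite (inj₂ (1≤a , a≤s , refl)) = inj₁ ((1≤a , ≤-trans a≤s s≤t) , t+a≰t 1≤a ∘ proj₂)

  adj-bipartite : Bipartition (Adj T) Leg
  adj-bipartite (inj₁ e) = SpE-bipartite e
  adj-bipartite (inj₂ e) = Sum.swap (Sum.map Prod.swap Prod.swap (SpE-bipartite e))

  triangle-free : TriangleFree T
  triangle-free = bipartite⇒triangle-free {P = Leg} adj-bipartite

  legs-nonadjacent : ∀ {x y} → Leg x → Leg y → ¬ Adj T x y
  legs-nonadjacent x-leg y-leg x~y =
    [ (λ (_ , ¬y-leg) → ¬y-leg y-leg) , (λ (¬x-leg , _) → ¬x-leg x-leg) ] (adj-bipartite x~y)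

  nonlegs-nonadjacent : ∀ {x y} → ¬ Leg x → ¬ Leg y → ¬ Adj T x y
  nonlegs-nonadjacent ¬x-leg ¬y-leg x~y =
    [ (λ (x-leg , _) → ¬x-leg x-leg) , (λ (_ , y-leg) → ¬y-leg y-leg) ] (adj-bipartite x~y)

  centre~leg : ∀ {v} → Leg v → Adj T zero v
  centre~leg v-leg = inj₁ (inj₁ (refl , v-leg))

  leg~centre : ∀ {v} → Leg v → Adj T v zero
  leg~centre v-leg = inj₂ (inj₁ (refl , v-leg))

  SpE-from-0 : ∀ {b} → SpE t s 0 b → LegIndex b
  SpE-from-0 (inj₁ (_ , b-leg)) = b-leg
  SpE-from-0 (inj₂ (() , _))

  ¬SpE-into-0 : ∀ {a} → ¬ SpE t s a 0
  ¬SpE-into-0 (inj₁ (_ , () , _))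
  ¬SpE-into-0 (inj₂ (1≤a , _ , 0≡t+a)) = t+a≢0 1≤a (sym 0≡t+a)

  SpE-parent-unique : ∀ {a b c} → SpE t s a c → SpE t s b c → a ≡ b
  SpE-parent-unique (inj₁ (refl , _))       (inj₁ (refl , _))        = refl
  SpE-parent-unique (inj₁ (_ , _ , c≤t))    (inj₂ (1≤b , _ , refl))  = ⊥-elim (t+a≰t 1≤b c≤t)
  SpE-parent-unique (inj₂ (1≤a , _ , refl)) (inj₁ (_ , _ , c≤t))     = ⊥-elim (t+a≰t 1≤a c≤t)
  SpE-parent-unique (inj₂ (_ , _ , refl))   (inj₂ (_ , _ , t+a≡t+b)) = ℕ.+-cancelˡ-≡ t _ _ t+a≡t+b

  SpE-child-unique : ∀ {a b c} → a ≢ 0 → SpE t s a b → SpE t s a c → b ≡ c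
  SpE-child-unique a≢0 (inj₁ (a≡0 , _))      _                     = ⊥-elim (a≢0 a≡0)
  SpE-child-unique a≢0 (inj₂ _)              (inj₁ (a≡0 , _))      = ⊥-elim (a≢0 a≡0)
  SpE-child-unique _   (inj₂ (_ , _ , refl)) (inj₂ (_ , _ , refl)) = refl

  SpE-grandparent : ∀ {a b c} → SpE t s a b → SpE t s b c → a ≡ 0
  SpE-grandparent (inj₁ (a≡0 , _))        _                      = a≡0
  SpE-grandparent (inj₂ (1≤a , _ , refl)) (inj₁ (t+a≡0 , _))     = ⊥-elim (t+a≢0 1≤a t+a≡0)
  SpE-grandparent (inj₂ (1≤a , _ , refl)) (inj₂ (_ , t+a≤s , _)) = ⊥-elim (t+a≰t 1≤a (≤-trans t+a≤s s≤t))

  SpiderEdge : V × V → Set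
  SpiderEdge e = SpE t s (toℕ (proj₁ e)) (toℕ (proj₂ e))

  ordered-edge : ∀ {e} → Ordered e × Adj T (proj₁ e) (proj₂ e) → SpiderEdge e
  ordered-edge (_ , inj₁ e) = e
  ordered-edge {p , q} (p<q , inj₂ (inj₁ (q≡0 , _))) = ⊥-elim (ℕ.n≮0 (subst (toℕ p <_) q≡0 p<q))
  ordered-edge {p , q} (p<q , inj₂ (inj₂ (_ , _ , p≡t+q))) =
    ⊥-elim (ℕ.<⇒≱ p<q (subst (toℕ q ≤_) (sym p≡t+q) (ℕ.m≤n+m (toℕ q) t)))

  CentreEdge : V × V → Set
  CentreEdge e = proj₁ e ≡ zero × Leg (proj₂ e)

  centre-edge : ∀ {e} → SpiderEdge e → Endpoint zero e → CentreEdge e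
  centre-edge E (inj₁ refl) = refl , SpE-from-0 E
  centre-edge E (inj₂ refl) = ⊥-elim (¬SpE-into-0 E)

  edges-at-non-centre : ∀ {a e e′} → a ≢ zero → SpiderEdge e → SpiderEdge e′ →
                        Endpoint a e → Endpoint a e′ → e ≢ e′ → (zero , a) ≡ e ⊎ (zero , a) ≡ e′
  edges-at-non-centre {a} a≢0 E E′ (inj₁ refl) (inj₁ refl) e≢e′ =
    ⊥-elim (e≢e′ (cong (a ,_) (toℕ-injective (SpE-child-unique (a≢0 ∘ toℕ-injective) E E′))))
  edges-at-non-centre {a} _ E E′ (inj₂ refl) (inj₂ refl) e≢e′ =
    ⊥-elim (e≢e′ (cong (_, a) (toℕ-injective (SpE-parent-unique E E′))))
  edges-at-non-centre {a} _ E E′ (inj₂ refl) (inj₁ refl) _ =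
    inj₁ (cong (_, a) (sym (toℕ-injective (SpE-grandparent E E′))))
  edges-at-non-centre {a} _ E E′ (inj₁ refl) (inj₂ refl) _ =
    inj₂ (cong (_, a) (sym (toℕ-injective (SpE-grandparent E′ E))))

  another-leg : 2 ≤ t → ∀ a → ∃ λ i → Leg i × i ≢ a
  another-leg 2≤t a with toℕ a ℕ.≟ 1
  ... | yes a≡1 = leg 2 two , leg-Leg two ,
                  λ i≡a → ℕ.<⇒≢ ≤-refl (sym (trans (sym (toℕ-leg two)) (trans (cong toℕ i≡a) a≡1)))
    where
    two : LegIndex 2
    two = s≤s z≤n , 2≤t
  ... | no a≢1  = leg 1 one , leg-Leg one , λ i≡a → a≢1 (trans (sym (cong toℕ i≡a)) (toℕ-leg one))
    where
    one : LegIndex 1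
    one = ≤-refl , ≤-trans (s≤s z≤n) 2≤t

  Internal : V → Set
  Internal v = v ≡ zero ⊎ (1 ≤ toℕ v × toℕ v ≤ s)

  source-internal : ∀ {u v} → SpiderEdge (u , v) → Internal u
  source-internal (inj₁ (u≡0 , _))       = inj₁ (toℕ-injective u≡0)
  source-internal (inj₂ (1≤u , u≤s , _)) = inj₂ (1≤u , u≤s)

  edge-internal-end : ∀ {u v} → Adj T u v → Internal u ⊎ Internal v
  edge-internal-end (inj₁ e) = inj₁ (source-internal e)
  edge-internal-end (inj₂ e) = inj₂ (source-internal e)

  centre-isolates : Isolates (Adj T) zero
  centre-isolates u~v = Sum.map dominated dominated (edge-internal-end u~v)
    where
    dominated : ∀ {w} → Internal w → Dominates (Adj T) zero w
    dominated (inj₁ refl)        = inj₁ refl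
    dominated (inj₂ (1≤w , w≤s)) = inj₂ (leg~centre (1≤w , ≤-trans w≤s s≤t))

  ι[T]≡1 : 1 ≤ t → IsIota T 1
  ι[T]≡1 1≤t = ι≡1 (zero , leg 1 one , centre~leg (leg-Leg one)) centre-isolates
    where
    one : LegIndex 1
    one = ≤-refl , 1≤t

  module _ {F : List (V × V)} where
    open Subdivision T F

    subdivided-leg-in : Unique F → All CentreEdge F → t ∸ s < length F →
                        ∃ λ k → toℕ (proj₂ (lookup F k)) ≤ s
    subdivided-leg-in uniq centred d<|F| with any? (λ k → toℕ (proj₂ (lookup F k)) ≤? s)
    ... | yes found = found
    ... | no none   = ⊥-elim (ℕ.<⇒≱ d<|F| (injective⇒≤ offset-injective))
      where
      centred-at : ∀ k → CentreEdge (lookup F k)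
      centred-at k = All.lookup centred (∈-lookup k)

      s<leg : ∀ k → s < toℕ (proj₂ (lookup F k))
      s<leg k = ℕ.≰⇒> λ leg≤s → none (k , leg≤s)

      leg-injective : ∀ {k k′} → toℕ (proj₂ (lookup F k)) ≡ toℕ (proj₂ (lookup F k′)) → k ≡ k′
      leg-injective {k} {k′} eq = lookup-injective uniq
        (cong₂ _,_ (trans (proj₁ (centred-at k)) (sym (proj₁ (centred-at k′)))) (toℕ-injective eq))

      -- Otherwise F joins the centre to |F| > t − s distinct legs among the t − s legs s+1, …, t.
      offset : Fin (length F) → Fin (t ∸ s)
      offset k = fromℕ< (ℕ.∸-monoˡ-< (s≤s (proj₂ (proj₂ (centred-at k)))) (s<leg k))

      offset-injective : Injective _≡_ _≡_ offset
      offset-injective {k} {k′} eq = leg-injective (ℕ.∸-cancelʳ-≡ (s<leg k) (s<leg k′)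
        (trans (sym (toℕ-fromℕ< _)) (trans (cong toℕ eq) (toℕ-fromℕ< _))))

    centre-avoided : Unique F → All SpiderEdge F → All (Endpoint zero) F → t ∸ s < length F →
                     EdgeOutside _~_ (inj₁ zero)
    centre-avoided uniq shape incident d<|F| =
      inj₁ j , inj₁ foot , (j~foot , j-foot∉F) , j-outside , foot-outside
      where
      centred : All CentreEdge F
      centred = All.zipWith (λ (E , at-centre) → centre-edge E at-centre) (shape , incident)

      k : Fin (length F)
      k = proj₁ (subdivided-leg-in uniq centred d<|F|)

      j : V
      j = proj₂ (lookup F k)

      j≤s : toℕ j ≤ s
      j≤s = proj₂ (subdivided-leg-in uniq centred d<|F|)

      1≤j : 1 ≤ toℕ j
      1≤j = proj₁ (proj₂ (All.lookup centred (∈-lookup k)))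

      foot : V
      foot = fromℕ< (s≤s (ℕ.+-monoʳ-≤ t j≤s))

      toℕ-foot : toℕ foot ≡ t + toℕ j
      toℕ-foot = toℕ-fromℕ< _

      1≤foot : 1 ≤ toℕ foot
      1≤foot = subst (1 ≤_) (sym toℕ-foot) (ℕ.<-≤-trans 1≤j (ℕ.m≤n+m _ t))

      foot-nonleg : ¬ Leg foot
      foot-nonleg (_ , foot≤t) = t+a≰t 1≤j (subst (_≤ t) toℕ-foot foot≤t)

      j~foot : Adj T j foot
      j~foot = inj₁ (inj₂ (1≤j , j≤s , toℕ-foot))

      j-foot∉F : ¬ InF F j foot
      j-foot∉F = [ positive⇒≢zero 1≤j ∘ sym , positive⇒≢zero 1≤foot ∘ sym ] ∘ InF-endpoint incident

      centre-j∈F : InF F j zero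
      centre-j∈F =
        inj₂ (subst (λ c → (c , j) ∈ₗ F) (proj₁ (All.lookup centred (∈-lookup k))) (∈-lookup k))

      j-outside : ¬ Dominates _~_ (inj₁ zero) (inj₁ j)
      j-outside = [ positive⇒≢zero 1≤j ∘ inj₁-injective , (λ (_ , ∉F) → ∉F centre-j∈F) ]

      foot-outside : ¬ Dominates _~_ (inj₁ zero) (inj₁ foot)
      foot-outside = [ positive⇒≢zero 1≤foot ∘ inj₁-injective ,
                       (λ (foot~0 , _) → nonlegs-nonadjacent foot-nonleg centre-nonleg foot~0) ]

    non-centre-avoided : 2 ≤ t → ∀ {a} → a ≢ zero → Unique F → All SpiderEdge F → All (Endpoint a) F →
                         2 ≤ length F → EdgeOutside _~_ (inj₁ a)
    non-centre-avoided 2≤t {a} a≢0 uniq shape incident 2≤|F| =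
      inj₁ zero , inj₁ i , (centre~leg i-leg , centre-i∉F) , centre-outside , i-outside
      where
      k₀ : Fin (length F)
      k₀ = fromℕ< (≤-trans (s≤s z≤n) 2≤|F|)

      k₁ : Fin (length F)
      k₁ = proj₁ (∃-distinct-entry uniq 2≤|F| k₀)

      member : ∀ k → (zero , a) ≡ lookup F k → (zero , a) ∈ₗ F
      member k eq = subst (_∈ₗ F) (sym eq) (∈-lookup k)

      centre-a∈F : (zero , a) ∈ₗ F
      centre-a∈F = [ member k₁ , member k₀ ]
        (edges-at-non-centre a≢0 (All.lookup shape (∈-lookup k₁)) (All.lookup shape (∈-lookup k₀))
          (All.lookup incident (∈-lookup k₁)) (All.lookup incident (∈-lookup k₀))
          (proj₂ (∃-distinct-entry uniq 2≤|F| k₀)))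

      a-leg : Leg a
      a-leg = SpE-from-0 (All.lookup shape centre-a∈F)

      i : V
      i = proj₁ (another-leg 2≤t a)

      i-leg : Leg i
      i-leg = proj₁ (proj₂ (another-leg 2≤t a))

      i≢a : i ≢ a
      i≢a = proj₂ (proj₂ (another-leg 2≤t a))

      centre-i∉F : ¬ InF F zero i
      centre-i∉F = [ a≢0 , i≢a ∘ sym ] ∘ InF-endpoint incident

      centre-outside : ¬ Dominates _~_ (inj₁ a) (inj₁ zero)
      centre-outside = [ a≢0 ∘ sym ∘ inj₁-injective , (λ (_ , ∉F) → ∉F (inj₁ centre-a∈F)) ]

      i-outside : ¬ Dominates _~_ (inj₁ a) (inj₁ i)
      i-outside = [ i≢a ∘ inj₁-injective , (λ (i~a , _) → legs-nonadjacent i-leg a-leg i~a) ]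

    no-vertex-isolates : 2 ≤ t → IsEdgeSet T F → 2 ≤ length F → t ∸ s < length F →
                         ∀ x → EdgeOutside _~_ x
    no-vertex-isolates _ (edges , uniq) 2≤|F| _ (inj₂ k) =
      subdivision-vertex-avoided (All.map proj₁ edges) (proj₂ (∃-distinct-entry uniq 2≤|F| k))
    no-vertex-isolates 2≤t (edges , uniq) 2≤|F| d<|F| (inj₁ a) with All.all? (Endpoint? a) F
    ... | no ¬incident = missed-edge-avoided triangle-free adj?
                           (proj₂ (All.lookup edges (∈-lookup (Any.index missed)))) (lookup-index missed)
      where
      missed = ¬All⇒Any¬ (Endpoint? a) F ¬incident
    ... | yes incident = incident-avoided a incident
      where
      shape : All SpiderEdge F
      shape = All.map ordered-edge edges

      incident-avoided : ∀ a → All (Endpoint a) F → EdgeOutside _~_ (inj₁ a)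
      incident-avoided zero    at-centre = centre-avoided uniq shape at-centre d<|F|
      incident-avoided (suc _) at-a      = non-centre-avoided 2≤t (λ ()) uniq shape at-a 2≤|F|

    ι[T_F]≥2 : 2 ≤ t → IsEdgeSet T F → 2 ≤ length F → t ∸ s < length F →
               ∀ {k} → IsIota (Subdivide T F) k → 2 ≤ k
    ι[T_F]≥2 2≤t isE 2≤|F| d<|F| =
      2≤ι zero λ X → EdgeOutside-join X (no-vertex-isolates 2≤t isE 2≤|F| d<|F| (splitAt _ X))

  unsubdivided-leg-bound : (i : Fin (t ∸ s)) → suc (s + toℕ i) ≤ t
  unsubdivided-leg-bound i = ≤-trans (ℕ.+-monoʳ-< s (toℕ<n i)) (ℕ.≤-reflexive (ℕ.m+[n∸m]≡n s≤t))

  unsubdivided-leg : Fin (t ∸ s) → V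
  unsubdivided-leg i = leg (suc (s + toℕ i)) (s≤s z≤n , unsubdivided-leg-bound i)

  toℕ-unsubdivided-leg : ∀ i → toℕ (unsubdivided-leg i) ≡ suc (s + toℕ i)
  toℕ-unsubdivided-leg i = toℕ-leg (s≤s z≤n , unsubdivided-leg-bound i)

  unsubdivided-leg-injective : Injective _≡_ _≡_ unsubdivided-leg
  unsubdivided-leg-injective {i} {j} eq = toℕ-injective (ℕ.+-cancelˡ-≡ s _ _ (ℕ.suc-injective
    (trans (sym (toℕ-unsubdivided-leg i)) (trans (cong toℕ eq) (toℕ-unsubdivided-leg j)))))

  unsubdivided-edges : List (V × V)
  unsubdivided-edges = tabulate λ i → zero , unsubdivided-leg i

  Unsubdivided : V × V → Set
  Unsubdivided e = proj₁ e ≡ zero × s < toℕ (proj₂ e) × toℕ (proj₂ e) ≤ t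

  all-unsubdivided : All Unsubdivided unsubdivided-edges
  all-unsubdivided = All-tabulate⁺ λ i → refl ,
    subst (s <_) (sym (toℕ-unsubdivided-leg i)) (s≤s (ℕ.m≤m+n s (toℕ i))) ,
    subst (_≤ t) (sym (toℕ-unsubdivided-leg i)) (unsubdivided-leg-bound i)

  unsubdivided-edges-isEdgeSet : IsEdgeSet T unsubdivided-edges
  unsubdivided-edges-isEdgeSet =
    All.map edge all-unsubdivided , Unique-tabulate⁺ (unsubdivided-leg-injective ∘ cong proj₂)
    where
    edge : ∀ {e} → Unsubdivided e → Ordered e × Adj T (proj₁ e) (proj₂ e)
    edge (refl , s<q , q≤t) = ℕ.≤-<-trans z≤n s<q , centre~leg (ℕ.≤-<-trans z≤n s<q , q≤t)

  module _ where
    open Subdivision T unsubdivided-edges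

    centre-subdivides : ∀ k → zero ≡ proj₁ (lookup unsubdivided-edges k)
    centre-subdivides k = sym (proj₁ (All.lookup all-unsubdivided (∈-lookup k)))

    internal-dominated : ∀ {w} → Internal w → Dominates _~_ (inj₁ zero) (inj₁ w)
    internal-dominated (inj₁ refl)        = inj₁ refl
    internal-dominated (inj₂ (1≤w , w≤s)) = inj₂ (leg~centre (1≤w , ≤-trans w≤s s≤t) ,
      [ positive⇒≢zero 1≤w ∘ proj₁ ∘ All.lookup all-unsubdivided ,
        (λ centre-w∈F → ℕ.<⇒≱ (proj₁ (proj₂ (All.lookup all-unsubdivided centre-w∈F))) w≤s) ])

    centre-isolates-unsubdivided : Isolates _~_ (inj₁ zero)
    centre-isolates-unsubdivided {inj₁ _} {inj₁ _} (u~v , _) =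
      Sum.map internal-dominated internal-dominated (edge-internal-end u~v)
    centre-isolates-unsubdivided {inj₁ _} {inj₂ k} _ = inj₂ (inj₂ (inj₁ (centre-subdivides k)))
    centre-isolates-unsubdivided {inj₂ k} {inj₁ _} _ = inj₁ (inj₂ (inj₁ (centre-subdivides k)))

    ι[T-unsubdivided]≡1 : s < t → IsIota (Subdivide T unsubdivided-edges) 1
    ι[T-unsubdivided]≡1 s<t =
      ι≡1 (embed (inj₂ (proj₁ edge)) , embed (inj₁ zero) ,
           adj-join {inj₂ (proj₁ edge)} {inj₁ zero} (proj₂ edge))
          (Isolates-join {inj₁ zero} centre-isolates-unsubdivided)
      where
      embed : Vertex → Fin (n (Subdivide T unsubdivided-edges))
      embed = join (suc (t + s)) (length unsubdivided-edges)

      edge : ∃ λ k → inj₂ k ~ inj₁ zero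
      edge = subdivision-edge (∈-tabulate⁺ (fromℕ< (ℕ.m<n⇒0<n∸m s<t)))

spider-critical : ∀ {t s} → 2 ≤ t → s < t → Critical (Spider t s) (suc (t ∸ s))
spider-critical {t} {s} 2≤t s<t =
  subdividing-raises-ι ,
  unsubdivided-edges , unsubdivided-edges-isEdgeSet , length-tabulate _ ,
  1 , ι[T]≡1 1≤t , ι[T-unsubdivided]≡1 s<t
  where
  open SpiderProperties (ℕ.<⇒≤ s<t)

  1≤t : 1 ≤ t
  1≤t = ≤-trans (s≤s z≤n) 2≤t

  subdividing-raises-ι : ∀ F → IsEdgeSet T F → length F ≡ suc (t ∸ s) →
                         Σ ℕ λ a → Σ ℕ λ b → IsIota T a × IsIota (Subdivide T F) b × a < b
  subdividing-raises-ι F isE |F|≡1+d = 1 , proj₁ ι[T_F] , ι[T]≡1 1≤t , proj₂ ι[T_F] ,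
                                       ι[T_F]≥2 2≤t isE 2≤|F| d<|F| (proj₂ ι[T_F])
    where
    ι[T_F] : Σ ℕ (IsIota (Subdivide T F))
    ι[T_F] = ι-exists (Subdivide T F) (Subdivision.adj-subdivide? T F adj?)

    2≤|F| : 2 ≤ length F
    2≤|F| = subst (2 ≤_) (sym |F|≡1+d) (s≤s (ℕ.m<n⇒0<n∸m s<t))

    d<|F| : t ∸ s < length F
    d<|F| = subst (t ∸ s <_) (sym |F|≡1+d) ≤-refl

proposition3p1 : (t d : ℕ) → 2 ≤ t → 1 ≤ d → d ≤ t ∸ 1 →
    Critical (Spider t (t ∸ d)) (suc d)
proposition3p1 t d 2≤t 1≤d d≤t∸1 =
  subst (Critical (Spider t (t ∸ d)) ∘ suc) (ℕ.m∸[m∸n]≡n d≤t) (spider-critical 2≤t (ℕ.∸-monoʳ-< 1≤d d≤t))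
  where
  d≤t : d ≤ t
  d≤t = ≤-trans d≤t∸1 (ℕ.m∸n≤m t 1)
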